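{- Let $G$ be a cograph with at least two vertices, let $T$ be its cotree, and let $u$ be a vertex of $G$. Then $u$ is avoidable in $G$ if and only if either the parent $p(u)$ of $u$ in $T$ is a 0-node or $p(u)$ is a full 1-node.
   Context: All graphs are finite, simple and undirected. A vertex $v$ of a graph $G$ is avoidable if every induced path on three vertices with middle vertex $v$ is contained in an induced cycle of $G$. A graph $G$ is a cograph if every induced subgraph of $G$ on at least two vertices is disconnected or has disconnected complement (equivalently, $G$ has no induced path on four vertices). The cotree of a cograph $G$ is the unique rooted tree $T$ whose leaves are the vertices of $G$ (in one-to-one correspondence) and whose internal nodes are labelled 0-nodes or 1-nodes, such that: (i) two vertices of $G$ are adjacent iff their least common ancestor in $T$ is a 1-node; (ii) every internal node has at least two children; (iii) no two adjacent internal nodes of $T$ have the same type. $p(u)$ denotes the parent of $u$ in $T$. A 1-node is full if all its children are leaves of $T$. -}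

module Defs where

open import Data.Nat using (ℕ; zero; suc; _+_; _≤_)
open import Data.Fin using (Fin; toℕ)
open import Data.Bool using (Bool; true; false)
open import Data.Maybe using (Maybe; just; nothing)
open import Data.Sum using (_⊎_; inj₁; inj₂)
open import Data.Product using (Σ; ∃; _×_; _,_)
open import Relation.Binary.PropositionalEquality using (_≡_; _≢_)
open import Relation.Nullary using (¬_)
open import Function.Bundles using (_⇔_)

record Graph (n : ℕ) : Set where
  field
    adj    : Fin n → Fin n → Bool
    sym    : ∀ x y → adj x y ≡ adj y x
    irrefl : ∀ x → adj x x ≡ false
open Graph public

Adj : ∀ {n} → Graph n → Fin n → Fin n → Set
Adj G x y = adj G x y ≡ true

InducedP3 : ∀ {n} → Graph n → Fin n → Fin n → Fin n → Set
InducedP3 G a v b = Adj G a v × Adj G v b × ¬ Adj G a b × a ≢ b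

InducedP4 : ∀ {n} → Graph n → Fin n → Fin n → Fin n → Fin n → Set
InducedP4 G a b c d =
  (a ≢ b × a ≢ c × a ≢ d × b ≢ c × b ≢ d × c ≢ d) ×
  Adj G a b × Adj G b c × Adj G c d ×
  ¬ Adj G a c × ¬ Adj G b d × ¬ Adj G a d

Cograph : ∀ {n} → Graph n → Set
Cograph G = ∀ a b c d → ¬ InducedP4 G a b c d

CycAdj : (k : ℕ) → Fin k → Fin k → Set
CycAdj k i j =
  suc (toℕ i) ≡ toℕ j ⊎ suc (toℕ j) ≡ toℕ i ⊎
  (toℕ i ≡ 0 × suc (toℕ j) ≡ k) ⊎ (toℕ j ≡ 0 × suc (toℕ i) ≡ k)

record InducedCycle {n} (G : Graph n) : Set where
  field
    len     : ℕ
    len≥3   : 3 ≤ len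
    vert    : Fin len → Fin n
    inj     : ∀ i j → vert i ≡ vert j → i ≡ j
    induced : ∀ i j → Adj G (vert i) (vert j) ⇔ CycAdj len i j
open InducedCycle public

PathInCycle : ∀ {n} {G : Graph n} → InducedCycle G → Fin n → Fin n → Fin n → Set
PathInCycle C a v b =
  Σ (Fin (len C)) λ i → Σ (Fin (len C)) λ j → Σ (Fin (len C)) λ l →
    vert C i ≡ a × vert C j ≡ v × vert C l ≡ b ×
    CycAdj (len C) i j × CycAdj (len C) j l

Avoidable : ∀ {n} → Graph n → Fin n → Set
Avoidable G v = ∀ a b → InducedP3 G a v b →
  Σ (InducedCycle G) λ C → PathInCycle C a v b

data NodeType : Set where
  0-node 1-node : NodeType

-- nodes of the tree: leaves are the vertices (Fin n), internal nodes Fin m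
Node : ℕ → ℕ → Set
Node n m = Fin n ⊎ Fin m

-- Anc par x y : y is an ancestor of x (or x itself) w.r.t. the parent map
data Anc {n m : ℕ} (par : Node n m → Maybe (Fin m)) : Node n m → Node n m → Set where
  here : ∀ {x} → Anc par x x
  up   : ∀ {x p y} → par x ≡ just p → Anc par (inj₂ p) y → Anc par x y

IsLCA : ∀ {n m} → (Node n m → Maybe (Fin m)) → Node n m → Node n m → Node n m → Set
IsLCA par x y w = Anc par x w × Anc par y w ×
  (∀ z → Anc par x z → Anc par y z → Anc par w z)

record Cotree {n} (G : Graph n) : Set where
  field
    m      : ℕ
    label  : Fin m → NodeType
    par    : Node n m → Maybe (Fin m) -- parent map (nothing = root)
    root   : Node n m
    root-par : par root ≡ nothing
    root-anc : ∀ x → Anc par x root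
    two-children : ∀ i → Σ (Node n m) λ c₁ → Σ (Node n m) λ c₂ →
      c₁ ≢ c₂ × par c₁ ≡ just i × par c₂ ≡ just i
    alternating : ∀ i j → par (inj₂ i) ≡ just j → label i ≢ label j
    lca-adj : ∀ x y → x ≢ y →
      Adj G x y ⇔ Σ (Fin m) λ w → IsLCA par (inj₁ x) (inj₁ y) (inj₂ w) × label w ≡ 1-node
open Cotree public

Full : ∀ {n} {G : Graph n} (T : Cotree G) → Fin (m T) → Set
Full {n} T i = ∀ c → par T c ≡ just i → ∃ λ (v : Fin n) → c ≡ inj₁ v

ParentCondition : ∀ {n} {G : Graph n} → Cotree G → Fin n → Set
ParentCondition T u = Σ (Fin (m T)) λ p → par T (inj₁ u) ≡ just p ×
  (label T p ≡ 0-node ⊎ (label T p ≡ 1-node × Full T p))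

-- Let p be the parent of u in the cotree. If p is a 0-node, a leaf x below another child of p
-- is non-adjacent to u, while every neighbour of u lies outside the subtree of p and hence has
-- the same least common ancestor with x as with u; so every induced a - u - b closes into the
-- induced 4-cycle a - u - b - x. If p is a full 1-node, its leaf children are true twins, so
-- the endpoints a, b of an induced a - u - b lie outside the subtree of p, and the same
-- construction works around the grandparent of u, a 0-node. Conversely, if p is a 1-node with
-- an internal child i, leaves a, b below two children of i give an induced a - u - b; every
-- neighbour of b other than u is adjacent to u, whereas in an induced cycle through a - u - b
-- the other cycle neighbour of b is not.

module Submission where

open import Defs hiding (sym)
open import Data.Nat using (ℕ; zero; suc; pred; _≤_; _<_; _≤′_; z≤n; s≤s; ≤′-refl; ≤′-step)
open import Data.Nat.Properties using (_≟_; ≤-trans; <-trans; <-irrefl; ≤∧≢⇒<; n<1+n; ≤⇒≤′)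
open import Data.Fin using (Fin; zero; suc; toℕ; fromℕ<; punchIn)
open import Data.Fin.Properties using (toℕ<n; toℕ-injective; toℕ-fromℕ<; pigeonhole; punchInᵢ≢i)
import Data.Fin.Properties as Fin
open import Data.Maybe using (Maybe; just; nothing)
open import Data.Maybe.Properties using (just-injective)
open import Data.Sum using (_⊎_; inj₁; inj₂)
import Data.Sum as Sum
open import Data.Sum.Properties using (≡-dec; inj₁-injective)
open import Data.Product using (Σ; ∃; _×_; _,_; proj₁; proj₂)
open import Data.Empty using (⊥; ⊥-elim)
open import Relation.Binary.PropositionalEquality
open import Relation.Nullary using (¬_; Dec; yes; no)
open import Relation.Nullary.Decidable using (False; toWitnessFalse; _⊎-dec_; _×-dec_)
open import Function.Bundles using (_⇔_; mk⇔; Equivalence)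

module CycleNeighbours where

  private
    variable
      k x y : ℕ

  -- CycAdj k i j unfolds to Cyc k (toℕ i) (toℕ j).
  Cyc : ℕ → ℕ → ℕ → Set
  Cyc k x y = suc x ≡ y ⊎ suc y ≡ x ⊎ (x ≡ 0 × suc y ≡ k) ⊎ (y ≡ 0 × suc x ≡ k)

  Cyc? : ∀ k x y → Dec (Cyc k x y)
  Cyc? k x y = suc x ≟ y ⊎-dec suc y ≟ x ⊎-dec x ≟ 0 ×-dec suc y ≟ k ⊎-dec y ≟ 0 ×-dec suc x ≟ k

  Cyc-sym : Cyc k x y → Cyc k y x
  Cyc-sym (inj₁ e)               = inj₂ (inj₁ e)
  Cyc-sym (inj₂ (inj₁ e))        = inj₁ e
  Cyc-sym (inj₂ (inj₂ (inj₁ e))) = inj₂ (inj₂ (inj₂ e))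
  Cyc-sym (inj₂ (inj₂ (inj₂ e))) = inj₂ (inj₂ (inj₁ e))

  next : ℕ → ℕ → ℕ
  next k x with suc x ≟ k
  ... | yes _ = 0
  ... | no  _ = suc x

  prev : ℕ → ℕ → ℕ
  prev k zero    = pred k
  prev k (suc x) = x

  next< : x < k → next k x < k
  next< {x} {k} x<k with suc x ≟ k
  ... | yes _ = ≤-trans (s≤s z≤n) x<k
  ... | no  ≢ = ≤∧≢⇒< x<k ≢

  prev< : x < k → prev k x < k
  prev< {zero}  {suc k} _   = n<1+n k
  prev< {suc x}         x<k = <-trans (n<1+n x) x<k

  Cyc-next : ∀ k x → Cyc k x (next k x)
  Cyc-next k x with suc x ≟ k
  ... | yes e = inj₂ (inj₂ (inj₂ (refl , e)))
  ... | no  _ = inj₁ refl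

  Cyc-prev : x < k → Cyc k x (prev k x)
  Cyc-prev {zero}  {suc k} _ = inj₂ (inj₂ (inj₁ (refl , refl)))
  Cyc-prev {suc x}         _ = inj₂ (inj₁ refl)

  Cyc⇒next⊎prev : y < k → Cyc k x y → y ≡ next k x ⊎ y ≡ prev k x
  Cyc⇒next⊎prev {k = k} {x} y<k (inj₁ refl) with suc x ≟ k
  ... | yes refl = ⊥-elim (<-irrefl refl y<k)
  ... | no  _    = inj₁ refl
  Cyc⇒next⊎prev y<k (inj₂ (inj₁ refl))                 = inj₂ refl
  Cyc⇒next⊎prev y<k (inj₂ (inj₂ (inj₁ (refl , refl)))) = inj₂ refl
  Cyc⇒next⊎prev {k = k} {x} y<k (inj₂ (inj₂ (inj₂ (refl , e)))) with suc x ≟ k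
  ... | yes _ = inj₁ refl
  ... | no  ≢ = ⊥-elim (≢ e)

  next≢prev : 3 ≤ k → x < k → next k x ≢ prev k x
  next≢prev {suc (suc (suc k))} {zero}  (s≤s (s≤s (s≤s _))) _ ()
  next≢prev {suc (suc (suc k))} {suc x} (s≤s (s≤s (s≤s _))) _ with suc (suc x) ≟ suc (suc (suc k))
  ... | yes refl = λ ()
  ... | no  _    = λ ()

  private
    at-position : ∀ {k w} {l j : Fin k} → w < k → Cyc k (toℕ l) w → w ≢ toℕ j →
      ∃ λ w′ → CycAdj k l w′ × w′ ≢ j
    at-position w<k l~w w≢j =
      fromℕ< w<k , subst (Cyc _ _) (sym (toℕ-fromℕ< w<k)) l~w ,
      λ e → w≢j (trans (sym (toℕ-fromℕ< w<k)) (cong toℕ e))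

    two-values : ∀ {A : Set} {p q a b c : A} →
      a ≡ p ⊎ a ≡ q → b ≡ p ⊎ b ≡ q → c ≡ p ⊎ c ≡ q → a ≡ b ⊎ a ≡ c ⊎ b ≡ c
    two-values (inj₁ a) (inj₁ b) _        = inj₁ (trans a (sym b))
    two-values (inj₂ a) (inj₂ b) _        = inj₁ (trans a (sym b))
    two-values (inj₁ a) (inj₂ b) (inj₁ c) = inj₂ (inj₁ (trans a (sym c)))
    two-values (inj₁ a) (inj₂ b) (inj₂ c) = inj₂ (inj₂ (trans b (sym c)))
    two-values (inj₂ a) (inj₁ b) (inj₁ c) = inj₂ (inj₂ (trans b (sym c)))
    two-values (inj₂ a) (inj₁ b) (inj₂ c) = inj₂ (inj₁ (trans a (sym c)))

  another-neighbour : 3 ≤ k → {l j : Fin k} → CycAdj k l j → ∃ λ w → CycAdj k l w × w ≢ j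
  another-neighbour k≥3 {l} {j} l~j with Cyc⇒next⊎prev (toℕ<n j) l~j
  ... | inj₁ j≡next = at-position (prev< (toℕ<n l)) (Cyc-prev (toℕ<n l))
                        λ prev≡j → next≢prev k≥3 (toℕ<n l) (trans (sym j≡next) (sym prev≡j))
  ... | inj₂ j≡prev = at-position (next< (toℕ<n l)) (Cyc-next _ _)
                        λ next≡j → next≢prev k≥3 (toℕ<n l) (trans next≡j j≡prev)

  at-most-two-neighbours : {j a b c : Fin k} →
    CycAdj k j a → CycAdj k j b → CycAdj k j c → a ≡ b ⊎ a ≡ c ⊎ b ≡ c
  at-most-two-neighbours {a = a} {b} {c} j~a j~b j~c =
    Sum.map toℕ-injective (Sum.map toℕ-injective toℕ-injective)
      (two-values (Cyc⇒next⊎prev (toℕ<n a) j~a) (Cyc⇒next⊎prev (toℕ<n b) j~b)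
                  (Cyc⇒next⊎prev (toℕ<n c) j~c))

open CycleNeighbours

another-element : ∀ {n} → 2 ≤ n → (u : Fin n) → ∃ λ v → v ≢ u
another-element (s≤s (s≤s _)) u = punchIn u zero , punchInᵢ≢i u zero

module GraphFacts {n : ℕ} (G : Graph n) where

  private
    variable
      a b u v w : Fin n

  Adj-sym : Adj G v w → Adj G w v
  Adj-sym {v} {w} vw = trans (Graph.sym G w v) vw

  Adj-irrefl : ¬ Adj G v v
  Adj-irrefl {v} vv with trans (sym vv) (irrefl G v)
  ... | ()

  Adj⇒≢ : Adj G v w → v ≢ w
  Adj⇒≢ vw refl = Adj-irrefl vw

  InducedP3-sym : InducedP3 G a v b → InducedP3 G b v a
  InducedP3-sym (av , vb , ¬ab , a≢b) =
    Adj-sym vb , Adj-sym av , (λ ba → ¬ab (Adj-sym ba)) , λ b≡a → a≢b (sym b≡a)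

  inducedC4 : InducedP3 G a u b → Adj G b w → Adj G w a → ¬ Adj G u w → u ≢ w →
    Σ (InducedCycle G) λ C → PathInCycle C a u b
  inducedC4 {a} {u} {b} {w} (au , ub , ¬ab , a≢b) bw wa ¬uw u≢w =
    C4 , 0F , 1F , 2F , refl , refl , refl , inj₁ refl , inj₁ refl
    where
    pattern 0F = zero
    pattern 1F = suc zero
    pattern 2F = suc (suc zero)
    pattern 3F = suc (suc (suc zero))

    corner : Fin 4 → Fin n
    corner 0F = a
    corner 1F = u
    corner 2F = b
    corner 3F = w

    corner-injective : ∀ i j → corner i ≡ corner j → i ≡ j
    corner-injective 0F 0F _ = refl
    corner-injective 1F 1F _ = refl
    corner-injective 2F 2F _ = refl
    corner-injective 3F 3F _ = refl
    corner-injective 0F 1F e = ⊥-elim (Adj⇒≢ au e)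
    corner-injective 0F 2F e = ⊥-elim (a≢b e)
    corner-injective 0F 3F e = ⊥-elim (Adj⇒≢ wa (sym e))
    corner-injective 1F 0F e = ⊥-elim (Adj⇒≢ au (sym e))
    corner-injective 1F 2F e = ⊥-elim (Adj⇒≢ ub e)
    corner-injective 1F 3F e = ⊥-elim (u≢w e)
    corner-injective 2F 0F e = ⊥-elim (a≢b (sym e))
    corner-injective 2F 1F e = ⊥-elim (Adj⇒≢ ub (sym e))
    corner-injective 2F 3F e = ⊥-elim (Adj⇒≢ bw e)
    corner-injective 3F 0F e = ⊥-elim (Adj⇒≢ wa e)
    corner-injective 3F 1F e = ⊥-elim (u≢w (sym e))
    corner-injective 3F 2F e = ⊥-elim (Adj⇒≢ bw (sym e))

    edge : ∀ {i j} → Adj G (corner i) (corner j) → CycAdj 4 i j →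
      Adj G (corner i) (corner j) ⇔ CycAdj 4 i j
    edge adj cyc = mk⇔ (λ _ → cyc) (λ _ → adj)

    non-edge : ∀ {i j} → ¬ Adj G (corner i) (corner j) → {False (Cyc? 4 (toℕ i) (toℕ j))} →
      Adj G (corner i) (corner j) ⇔ CycAdj 4 i j
    non-edge ¬adj {¬cyc} = mk⇔ (λ adj → ⊥-elim (¬adj adj)) (λ cyc → ⊥-elim (toWitnessFalse ¬cyc cyc))

    corner-induced : ∀ i j → Adj G (corner i) (corner j) ⇔ CycAdj 4 i j
    corner-induced 0F 0F = non-edge Adj-irrefl
    corner-induced 1F 1F = non-edge Adj-irrefl
    corner-induced 2F 2F = non-edge Adj-irrefl
    corner-induced 3F 3F = non-edge Adj-irrefl
    corner-induced 0F 1F = edge au (inj₁ refl)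
    corner-induced 1F 2F = edge ub (inj₁ refl)
    corner-induced 2F 3F = edge bw (inj₁ refl)
    corner-induced 3F 0F = edge wa (inj₂ (inj₂ (inj₂ (refl , refl))))
    corner-induced 1F 0F = edge (Adj-sym au) (inj₂ (inj₁ refl))
    corner-induced 2F 1F = edge (Adj-sym ub) (inj₂ (inj₁ refl))
    corner-induced 3F 2F = edge (Adj-sym bw) (inj₂ (inj₁ refl))
    corner-induced 0F 3F = edge (Adj-sym wa) (inj₂ (inj₂ (inj₁ (refl , refl))))
    corner-induced 0F 2F = non-edge ¬ab
    corner-induced 2F 0F = non-edge λ ba → ¬ab (Adj-sym ba)
    corner-induced 1F 3F = non-edge ¬uw
    corner-induced 3F 1F = non-edge λ wu → ¬uw (Adj-sym wu)

    C4 : InducedCycle G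
    C4 = record { len = 4 ; len≥3 = s≤s (s≤s (s≤s z≤n)) ; vert = corner
                ; inj = corner-injective ; induced = corner-induced }

  -- The witness is the neighbour of b on the cycle other than v.
  inducedCycle-privateNeighbour : InducedP3 G a v b → (C : InducedCycle G) → PathInCycle C a v b →
    ∃ λ w → Adj G w b × w ≢ v × ¬ Adj G w v
  inducedCycle-privateNeighbour (_ , _ , ¬ab , a≢b) C (i , j , l , refl , refl , refl , i~j , j~l)
    with another-neighbour (len≥3 C) (Cyc-sym j~l)
  ... | w , l~w , w≢j = vert C w , edge-of (Cyc-sym l~w) , (λ e → w≢j (inj C w j e)) , ¬wj
    where
    edge-of : ∀ {s t} → CycAdj (len C) s t → Adj G (vert C s) (vert C t)
    edge-of = Equivalence.from (induced C _ _)

    ¬wj : ¬ Adj G (vert C w) (vert C j)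
    ¬wj wj with at-most-two-neighbours (Cyc-sym i~j) j~l (Cyc-sym (Equivalence.to (induced C w j) wj))
    ... | inj₁ i≡l        = a≢b (cong (vert C) i≡l)
    ... | inj₂ (inj₁ refl) = ¬ab (edge-of (Cyc-sym l~w))
    ... | inj₂ (inj₂ refl) = Adj-irrefl (edge-of l~w)

module Ancestry {n m : ℕ} (par : Node n m → Maybe (Fin m)) where

  infix 4 _≼_
  _≼_ : Node n m → Node n m → Set
  _≼_ = Anc par

  private
    variable
      x x′ y z r w : Node n m
      p : Fin m
      u v : Fin n

  ≼-trans : x ≼ y → y ≼ z → x ≼ z
  ≼-trans here         y≼z = y≼z
  ≼-trans (up e p≼y) y≼z = up e (≼-trans p≼y y≼z)

  ≼-comparable : x ≼ y → x ≼ z → y ≼ z ⊎ z ≼ y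
  ≼-comparable here        x≼z         = inj₁ x≼z
  ≼-comparable (up e p≼y) here        = inj₂ (up e p≼y)
  ≼-comparable (up e p≼y) (up e′ p≼z) with just-injective (trans (sym e) e′)
  ... | refl = ≼-comparable p≼y p≼z

  ≼-parent : par x ≡ just p → x ≼ z → z ≡ x ⊎ inj₂ p ≼ z
  ≼-parent e here         = inj₁ refl
  ≼-parent e (up e′ p≼z) with just-injective (trans (sym e) e′)
  ... | refl = inj₂ p≼z

  ≼-parentless : par x ≡ nothing → x ≼ y → y ≡ x
  ≼-parentless e here        = refl
  ≼-parentless e (up e′ _) with trans (sym e) e′
  ... | ()

  ≼-leaf : x ≼ inj₁ v → x ≡ inj₁ v
  ≼-leaf here        = refl
  ≼-leaf (up _ p≼v) with ≼-leaf p≼v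
  ... | ()

  leaf-⋠ : u ≢ v → ¬ inj₁ u ≼ inj₁ v
  leaf-⋠ u≢v u≼v = u≢v (inj₁-injective (≼-leaf u≼v))

  IsLCA-sym : IsLCA par x y w → IsLCA par y x w
  IsLCA-sym (x≼w , y≼w , least) = y≼w , x≼w , λ z y≼z x≼z → least z x≼z y≼z

  IsLCA-self : y ≼ x → IsLCA par x y x
  IsLCA-self y≼x = here , y≼x , λ _ x≼z _ → x≼z

  IsLCA-child : par x ≡ just p → ¬ y ≼ x → IsLCA par (inj₂ p) y w → IsLCA par x y w
  IsLCA-child {x = x} {y = y} {w = w} e y⋠x (p≼w , y≼w , least) = up e p≼w , y≼w , least′
    where
    least′ : ∀ z → x ≼ z → y ≼ z → w ≼ z
    least′ z x≼z y≼z with ≼-parent e x≼z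
    ... | inj₁ refl = ⊥-elim (y⋠x y≼z)
    ... | inj₂ p≼z  = least z p≼z y≼z

  IsLCA-raise : x ≼ x′ → x′ ≼ w → IsLCA par x y w → IsLCA par x′ y w
  IsLCA-raise x≼x′ x′≼w (_ , y≼w , least) =
    x′≼w , y≼w , λ z x′≼z y≼z → least z (≼-trans x≼x′ x′≼z) y≼z

  IsLCA-sibling : par x ≡ just p → par x′ ≡ just p → ¬ y ≼ x → ¬ y ≼ x′ →
    IsLCA par x y w → IsLCA par x′ y w
  IsLCA-sibling {y = y} e e′ y⋠x y⋠x′ lca@(x≼w , y≼w , _) with ≼-parent e x≼w
  ... | inj₁ refl = ⊥-elim (y⋠x y≼w)
  ... | inj₂ p≼w  = IsLCA-child e′ y⋠x′ (IsLCA-raise (up e here) p≼w lca)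

  -- Every common ancestor of a node below r and a node outside the subtree of r lies above r.
  IsLCA-outside : x ≼ r → x′ ≼ r → ¬ y ≼ r → IsLCA par x y w → IsLCA par x′ y w
  IsLCA-outside {x} {r} {x′} {y} x≼r x′≼r y⋠r (x≼w , y≼w , least) =
    ≼-trans x′≼r (above x≼r x≼w y≼w) , y≼w ,
    λ z x′≼z y≼z → least z (≼-trans x≼r (above x′≼r x′≼z y≼z)) y≼z
    where
    above : ∀ {s z} → s ≼ r → s ≼ z → y ≼ z → r ≼ z
    above s≼r s≼z y≼z with ≼-comparable s≼r s≼z
    ... | inj₁ r≼z = r≼z
    ... | inj₂ z≼r = ⊥-elim (y⋠r (≼-trans y≼z z≼r))

  IsLCA-leaves-distinct : ∀ {p} → IsLCA par (inj₁ u) (inj₁ v) (inj₂ p) → u ≢ v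
  IsLCA-leaves-distinct (_ , _ , least) refl with ≼-leaf (least _ here here)
  ... | ()

module CotreeFacts {n : ℕ} {G : Graph n} (T : Cotree G) where

  open GraphFacts G
  open Ancestry (par T)

  private
    K = m T
    variable
      c c′ x y z z′ : Node n K
      i j p w : Fin K
      a b u v : Fin n

  no-cycle : par T x ≡ just p → ¬ inj₂ p ≼ x
  no-cycle e = go (root-anc T _) e
    where
    go : x ≼ root T → par T x ≡ just p → ¬ inj₂ p ≼ x
    go here e _ with trans (sym (root-par T)) e
    ... | ()
    go (up e′ x≼root) e p≼x with just-injective (trans (sym e) e′) | p≼x
    ... | refl | here          = go x≼root e here
    ... | refl | up e″ q≼x = go x≼root e″ (≼-trans q≼x (up e here))

  ≼-antisym : x ≼ y → y ≼ x → x ≡ y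
  ≼-antisym here        _   = refl
  ≼-antisym (up e p≼y) y≼x = ⊥-elim (no-cycle e (≼-trans p≼y y≼x))

  parentless-top : par T x ≡ nothing → ∀ y → y ≼ x
  parentless-top e y = subst (y ≼_) (≼-parentless e (root-anc T _)) (root-anc T y)

  siblings-incomparable : par T c ≡ just i → par T c′ ≡ just i → c ≢ c′ → ¬ c ≼ c′
  siblings-incomparable e e′ c≢c′ c≼c′ with ≼-parent e c≼c′
  ... | inj₁ c′≡c = c≢c′ (sym c′≡c)
  ... | inj₂ i≼c′ = no-cycle e′ i≼c′

  siblings-disjoint : par T c ≡ just i → par T c′ ≡ just i → c ≢ c′ → x ≼ c → x ≼ c′ → ⊥
  siblings-disjoint e e′ c≢c′ x≼c x≼c′ with ≼-comparable x≼c x≼c′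
  ... | inj₁ c≼c′ = siblings-incomparable e e′ c≢c′ c≼c′
  ... | inj₂ c′≼c = siblings-incomparable e′ e (λ c′≡c → c≢c′ (sym c′≡c)) c′≼c

  IsLCA-unique : IsLCA (par T) x y z → IsLCA (par T) x y z′ → z ≡ z′
  IsLCA-unique (x≼z , y≼z , least) (x≼z′ , y≼z′ , least′) =
    ≼-antisym (least _ x≼z′ y≼z′) (least′ _ x≼z y≼z)

  IsLCA-siblings : ∀ {c c′ x y i} → par T c ≡ just i → par T c′ ≡ just i → c ≢ c′ →
    x ≼ c → y ≼ c′ → IsLCA (par T) x y (inj₂ i)
  IsLCA-siblings {x = x} {y} {i} e e′ c≢c′ x≼c y≼c′ =
    ≼-trans x≼c (up e here) , ≼-trans y≼c′ (up e′ here) , least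
    where
    least : ∀ z → x ≼ z → y ≼ z → inj₂ i ≼ z
    least z x≼z y≼z with ≼-comparable x≼c x≼z
    ... | inj₂ z≼c = ⊥-elim (siblings-disjoint e e′ c≢c′ (≼-trans y≼z z≼c) y≼c′)
    ... | inj₁ c≼z with ≼-parent e c≼z
    ...   | inj₁ refl = ⊥-elim (siblings-disjoint e e′ c≢c′ y≼z y≼c′)
    ...   | inj₂ i≼z  = i≼z

  first-child : Fin K → Node n K
  first-child i = proj₁ (two-children T i)

  first-child-parent : ∀ i → par T (first-child i) ≡ just i
  first-child-parent i = proj₁ (proj₂ (proj₂ (proj₂ (two-children T i))))

  other-child : ∀ i d → ∃ λ c → par T c ≡ just i × c ≢ d
  other-child i d with two-children T i
  ... | c₁ , c₂ , c₁≢c₂ , e₁ , e₂ with ≡-dec Fin._≟_ Fin._≟_ c₁ d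
  ...   | yes refl = c₂ , e₂ , λ c₂≡c₁ → c₁≢c₂ (sym c₂≡c₁)
  ...   | no  c₁≢d = c₁ , e₁ , c₁≢d

  down : Node n K → Node n K
  down (inj₁ v) = inj₁ v
  down (inj₂ i) = first-child i

  descend : Node n K → ℕ → Node n K
  descend x zero    = x
  descend x (suc t) = down (descend x t)

  descend-mono : ∀ {s t} → s ≤′ t → descend x t ≼ descend x s
  descend-mono ≤′-refl = here
  descend-mono {x} (≤′-step {t} s≤′t) with descend x t | descend-mono {x} s≤′t
  ... | inj₁ _ | below = below
  ... | inj₂ i | below = up (first-child-parent i) below

  -- Descending K + 1 times through internal nodes would visit some internal node twice.
  leaf-below : ∀ x → ∃ λ v → inj₁ v ≼ x
  leaf-below (inj₁ v) = v , here
  leaf-below (inj₂ i) =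
    let _ , _ , s<t , same = pigeonhole (n<1+n K) (λ t → index-or-root (descend (inj₂ i) (toℕ t)))
    in repetition⇒leaf (≤⇒≤′ s<t) refl refl same
    where
    index-or-root : Node n K → Fin K
    index-or-root (inj₁ _) = i
    index-or-root (inj₂ j) = j

    below-i : ∀ t → descend (inj₂ i) t ≼ inj₂ i
    below-i t = descend-mono {t = t} (≤⇒≤′ z≤n)

    repetition⇒leaf : ∀ {s t} {y z} → suc s ≤′ t → descend (inj₂ i) s ≡ y → descend (inj₂ i) t ≡ z →
      index-or-root y ≡ index-or-root z → ∃ λ v → inj₁ v ≼ inj₂ i
    repetition⇒leaf {s}     {y = inj₁ v}            _   es _  _    = v , subst (_≼ inj₂ i) es (below-i s)
    repetition⇒leaf {t = t} {y = inj₂ _} {inj₁ v}   _   _  et _    = v , subst (_≼ inj₂ i) et (below-i t)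
    repetition⇒leaf         {y = inj₂ j} {inj₂ .j}  s<t es et refl =
      ⊥-elim (no-cycle (first-child-parent j) (subst₂ _≼_ et (cong down es) (descend-mono s<t)))

  leaf-has-parent : 2 ≤ n → ∀ u → ∃ λ p → par T (inj₁ u) ≡ just p
  leaf-has-parent n≥2 u with par T (inj₁ u) in e
  ... | just p  = p , refl
  ... | nothing =
    let v , v≢u = another-element n≥2 u
    in ⊥-elim (v≢u (inj₁-injective (≼-leaf (parentless-top e (inj₁ v)))))

  LCA : Fin n → Fin n → Fin K → Set
  LCA u v w = IsLCA (par T) (inj₁ u) (inj₁ v) (inj₂ w)

  LCA-1⇒Adj : LCA u v w → label T w ≡ 1-node → Adj G u v
  LCA-1⇒Adj lca lw = Equivalence.from (lca-adj T _ _ (IsLCA-leaves-distinct lca)) (_ , lca , lw)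

  Adj⇒LCA-1 : Adj G u v → ∃ λ w → LCA u v w × label T w ≡ 1-node
  Adj⇒LCA-1 uv = Equivalence.to (lca-adj T _ _ (Adj⇒≢ uv)) uv

  LCA-0⇒¬Adj : LCA u v w → label T w ≡ 0-node → ¬ Adj G u v
  LCA-0⇒¬Adj lca lw uv with Adj⇒LCA-1 uv
  ... | _ , lca′ , lw′ with IsLCA-unique lca lca′
  ... | refl with trans (sym lw) lw′
  ... | ()

  child-of-1-node : par T (inj₂ i) ≡ just j → label T j ≡ 1-node → label T i ≡ 0-node
  child-of-1-node {i} {j} e lj with label T i in li
  ... | 0-node = refl
  ... | 1-node = ⊥-elim (alternating T i j e (trans li (sym lj)))

  parent-of-1-node : par T (inj₂ i) ≡ just j → label T i ≡ 1-node → label T j ≡ 0-node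
  parent-of-1-node {i} {j} e li with label T j in lj
  ... | 0-node = refl
  ... | 1-node = ⊥-elim (alternating T i j e (trans li (sym lj)))

  -- x takes over the neighbours of u outside the subtree of r, and r separates u from x.
  inducedC4-around-0-node : ∀ {r u x a b} → label T r ≡ 0-node → LCA u x r →
    ¬ inj₁ a ≼ inj₂ r → ¬ inj₁ b ≼ inj₂ r → InducedP3 G a u b →
    Σ (InducedCycle G) λ C → PathInCycle C a u b
  inducedC4-around-0-node {r} {u} {x} lr lca-ux@(u≼r , x≼r , _) a⋠r b⋠r p3@(au , ub , _ , _) =
    inducedC4 p3 (Adj-sym (neighbour-of-x ub b⋠r)) (neighbour-of-x (Adj-sym au) a⋠r)
      (LCA-0⇒¬Adj lca-ux lr) (IsLCA-leaves-distinct lca-ux)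
    where
    neighbour-of-x : ∀ {v} → Adj G u v → ¬ inj₁ v ≼ inj₂ r → Adj G x v
    neighbour-of-x uv v⋠r with Adj⇒LCA-1 uv
    ... | _ , lca , lw = LCA-1⇒Adj (IsLCA-outside u≼r x≼r v⋠r lca) lw

  module Parent {u : Fin n} {p : Fin K} (eu : par T (inj₁ u) ≡ just p) where

    LCA-below-parent : v ≢ u → inj₁ v ≼ inj₂ p → LCA u v p
    LCA-below-parent v≢u v≼p = IsLCA-child eu (leaf-⋠ v≢u) (IsLCA-self v≼p)

    adj-below-1-parent : label T p ≡ 1-node → inj₁ b ≼ inj₂ p → v ≢ u → Adj G v b → Adj G v u
    adj-below-1-parent lp b≼p v≢u vb with Adj⇒LCA-1 vb
    ... | _ , lca@(v≼w , b≼w , _) , lw with ≼-comparable b≼w b≼p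
    ...   | inj₁ w≼p = Adj-sym (LCA-1⇒Adj (LCA-below-parent v≢u (≼-trans v≼w w≼p)) lp)
    ...   | inj₂ p≼w =
      Adj-sym (LCA-1⇒Adj (IsLCA-child eu (leaf-⋠ v≢u) (IsLCA-raise b≼p p≼w (IsLCA-sym lca))) lw)

    internal-child⇒¬avoidable : label T p ≡ 1-node → par T (inj₂ i) ≡ just p → ¬ Avoidable G u
    internal-child⇒¬avoidable {i} lp ei avoidable with two-children T i
    ... | c₁ , c₂ , c₁≢c₂ , e₁ , e₂ with leaf-below c₁ | leaf-below c₂
    ... | a , a≼c₁ | b , b≼c₂ =
      let C , path         = avoidable a b a-u-b
          w , wb , w≢u , ¬wu = inducedCycle-privateNeighbour a-u-b C path
      in ¬wu (adj-below-1-parent lp (≼-trans b≼i (up ei here)) w≢u wb)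
      where
      lca-ab : LCA a b i
      lca-ab = IsLCA-siblings e₁ e₂ c₁≢c₂ a≼c₁ b≼c₂
      a≼i = proj₁ lca-ab
      b≼i = proj₁ (proj₂ lca-ab)

      adj-u : ∀ {v} → inj₁ v ≼ inj₂ i → Adj G u v
      adj-u v≼i = LCA-1⇒Adj (LCA-below-parent v≢u (≼-trans v≼i (up ei here))) lp
        where
        v≢u : _ ≢ u
        v≢u refl = siblings-disjoint eu ei (λ ()) here v≼i

      a-u-b : InducedP3 G a u b
      a-u-b = Adj-sym (adj-u a≼i) , adj-u b≼i ,
              LCA-0⇒¬Adj lca-ab (child-of-1-node ei lp) , IsLCA-leaves-distinct lca-ab

    avoidable-1-parent⇒full : label T p ≡ 1-node → Avoidable G u → Full T p
    avoidable-1-parent⇒full lp avoidable (inj₁ v) _  = v , refl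
    avoidable-1-parent⇒full lp avoidable (inj₂ i) ei =
      ⊥-elim (internal-child⇒¬avoidable lp ei avoidable)

    0-parent⇒avoidable : label T p ≡ 0-node → Avoidable G u
    0-parent⇒avoidable lp a b a-u-b@(au , ub , _) =
      let c , ec , c≢u = other-child p (inj₁ u)
          x , x≼c      = leaf-below c
      in inducedC4-around-0-node lp (IsLCA-siblings eu ec (λ u≡c → c≢u (sym u≡c)) here x≼c)
           (outside (Adj-sym au)) (outside ub) a-u-b
      where
      outside : Adj G u v → ¬ inj₁ v ≼ inj₂ p
      outside uv v≼p = LCA-0⇒¬Adj (LCA-below-parent (Adj⇒≢ (Adj-sym uv)) v≼p) lp uv

    below-full : Full T p → inj₂ i ≼ inj₂ p → i ≡ p
    below-full full here         = refl
    below-full full (up e j≼p) with below-full full j≼p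
    ... | refl with full _ e
    ... | _ , ()

    leaf-below-full : Full T p → inj₁ v ≼ inj₂ p → par T (inj₁ v) ≡ just p
    leaf-below-full full (up e j≼p) with below-full full j≼p
    ... | refl = e

    -- Leaves of a full 1-node are true twins, so a below p would be adjacent to b like u.
    ¬below-full-parent : Full T p → InducedP3 G a u b → ¬ inj₁ a ≼ inj₂ p
    ¬below-full-parent full (_ , ub , ¬ab , a≢b) a≼p with Adj⇒LCA-1 ub
    ... | _ , lca , lw =
      ¬ab (LCA-1⇒Adj (IsLCA-sibling eu (leaf-below-full full a≼p)
                        (leaf-⋠ (Adj⇒≢ (Adj-sym ub))) (leaf-⋠ λ b≡a → a≢b (sym b≡a)) lca) lw)

    full-1-parent⇒avoidable : label T p ≡ 1-node → Full T p → Avoidable G u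
    full-1-parent⇒avoidable lp full a b a-u-b with par T (inj₂ p) in ep
    ... | nothing = ⊥-elim (¬below-full-parent full a-u-b (parentless-top ep _))
    ... | just q  =
      let c , ec , c≢p = other-child q (inj₂ p)
          x , x≼c      = leaf-below c
      in inducedC4-around-0-node lq (IsLCA-siblings ep ec (λ p≡c → c≢p (sym p≡c)) (up eu here) x≼c)
           (outside a-u-b) (outside (InducedP3-sym a-u-b)) a-u-b
      where
      lq : label T q ≡ 0-node
      lq = parent-of-1-node ep lp

      outside : ∀ {v w} → InducedP3 G v u w → ¬ inj₁ v ≼ inj₂ q
      outside v-u-w@(vu , _) v≼q =
        LCA-0⇒¬Adj (IsLCA-child eu (leaf-⋠ (Adj⇒≢ vu))
                      (IsLCA-child ep (¬below-full-parent full v-u-w) (IsLCA-self v≼q)))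
                   lq (Adj-sym vu)

  avoidable⇒condition : 2 ≤ n → Avoidable G u → ParentCondition T u
  avoidable⇒condition {u} n≥2 avoidable with leaf-has-parent n≥2 u
  ... | p , eu with label T p in lp
  ...   | 0-node = p , eu , inj₁ lp
  ...   | 1-node = p , eu , inj₂ (lp , Parent.avoidable-1-parent⇒full eu lp avoidable)

  condition⇒avoidable : ParentCondition T u → Avoidable G u
  condition⇒avoidable (_ , eu , inj₁ lp)          = Parent.0-parent⇒avoidable eu lp
  condition⇒avoidable (_ , eu , inj₂ (lp , full)) = Parent.full-1-parent⇒avoidable eu lp full

lemma4 : ∀ {n} (G : Graph n) → 2 ≤ n → Cograph G → (T : Cotree G) → (u : Fin n) →
    Avoidable G u ⇔ ParentCondition T u
lemma4 G n≥2 _ T u = mk⇔ (avoidable⇒condition n≥2) condition⇒avoidable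
  where open CotreeFacts T
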